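{- Let $(G_1,G_2,S)$ be a constrained alignment instance with $m_2=1$ (and $m_1$ any positive integer). Then for every $k\geq 7$, the wheel $W_k$ is not an induced subgraph of the conflict graph $\mathcal{C}$.
   Context: Let $G_1=(V_1,E_1)$ and $G_2=(V_2,E_2)$ be finite simple undirected graphs with $V_1\cap V_2=\emptyset$, and let $S$ be a bipartite graph with parts $V_1,V_2$ in which every vertex of $V_1$ has degree at most $m_1$ and every vertex of $V_2$ has degree at most $m_2$; edges of $S$ are similarity edges. A $c_4$ is a 4-cycle $a-b-c-d-a$ in $G_1\cup G_2\cup S$ with $a,b\in V_1$, $c,d\in V_2$, $ab\in E_1$, $cd\in E_2$, $ad,bc\in E(S)$, regarded as a subgraph. Two distinct $c_4$s conflict if their similarity edges cannot all belong to a common matching of $S$. The conflict graph $\mathcal{C}$ has one vertex per $c_4$ and an edge between each pair of conflicting $c_4$s. The wheel $W_k$ consists of a cycle $C_k$ together with one additional vertex adjacent to all vertices of the cycle. -}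

module Defs where

open import Data.Nat using (ℕ; zero; suc; _≤_)
open import Data.Fin using (Fin; toℕ) renaming (zero to fzero; suc to fsuc)
open import Data.Bool using (Bool; true; false)
open import Data.List using (List; length; filterᵇ; allFin)
open import Data.List.Membership.Propositional using (_∈_)
open import Data.Product using (Σ; _×_; _,_; proj₁; proj₂; ∃)
open import Data.Sum using (_⊎_)
open import Relation.Binary.PropositionalEquality using (_≡_; _≢_)
open import Relation.Nullary using (¬_)
open import Data.Empty using (⊥)
open import Data.Unit using (⊤)
open import Function.Bundles using (_⇔_)

record SimpleGraph (n : ℕ) : Set where
  field
    adj   : Fin n → Fin n → Bool
    sym   : ∀ i j → adj i j ≡ adj j i
    irrfl : ∀ i → adj i i ≡ false
open SimpleGraph public

-- V₁ = Fin n₁, V₂ = Fin n₂ (disjoint by construction); S is a bipartite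
-- graph between V₁ and V₂ given by sim : Fin n₁ → Fin n₂ → Bool.
record Instance (n₁ n₂ m₁ m₂ : ℕ) : Set where
  field
    G₁  : SimpleGraph n₁
    G₂  : SimpleGraph n₂
    sim : Fin n₁ → Fin n₂ → Bool
    deg₁ : ∀ (a : Fin n₁) → length (filterᵇ (λ c → sim a c) (allFin n₂)) ≤ m₁
    deg₂ : ∀ (c : Fin n₂) → length (filterᵇ (λ a → sim a c) (allFin n₁)) ≤ m₂
open Instance public

module _ {n₁ n₂ m₁ m₂ : ℕ} (I : Instance n₁ n₂ m₁ m₂) where

  record C4 : Set where
    constructor c4
    field
      a b : Fin n₁
      c d : Fin n₂
      ab∈E₁ : adj (G₁ I) a b ≡ true
      cd∈E₂ : adj (G₂ I) c d ≡ true
      ad∈S  : sim I a d ≡ true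
      bc∈S  : sim I b c ≡ true

  SimEdge : Set
  SimEdge = Fin n₁ × Fin n₂

  simEdge₁ simEdge₂ : C4 → SimEdge
  simEdge₁ q = C4.a q , C4.d q
  simEdge₂ q = C4.b q , C4.c q

  -- c4s are regarded as subgraphs: the tuples (a,b,c,d) and (b,a,d,c)
  -- describe the same subgraph (same vertices and same four edges).
  SameC4 : C4 → C4 → Set
  SameC4 p q =
      (C4.a p ≡ C4.a q × C4.b p ≡ C4.b q × C4.c p ≡ C4.c q × C4.d p ≡ C4.d q)
    ⊎ (C4.a p ≡ C4.b q × C4.b p ≡ C4.a q × C4.c p ≡ C4.d q × C4.d p ≡ C4.c q)

  IsMatchingOfS : List SimEdge → Set
  IsMatchingOfS M =
      (∀ {e} → e ∈ M → sim I (proj₁ e) (proj₂ e) ≡ true)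
    × (∀ {e e'} → e ∈ M → e' ∈ M →
         e ≡ e' ⊎ (proj₁ e ≢ proj₁ e' × proj₂ e ≢ proj₂ e'))

  Conflict : C4 → C4 → Set
  Conflict p q = ¬ (Σ (List SimEdge) λ M → IsMatchingOfS M
                     × simEdge₁ p ∈ M × simEdge₂ p ∈ M
                     × simEdge₁ q ∈ M × simEdge₂ q ∈ M)

CycleAdj : (k : ℕ) → Fin k → Fin k → Set
CycleAdj k i j =
    suc (toℕ i) ≡ toℕ j
  ⊎ suc (toℕ j) ≡ toℕ i
  ⊎ (toℕ i ≡ 0 × suc (toℕ j) ≡ k)
  ⊎ (toℕ j ≡ 0 × suc (toℕ i) ≡ k)

WheelAdj : (k : ℕ) → Fin (suc k) → Fin (suc k) → Set
WheelAdj k fzero    fzero    = ⊥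
WheelAdj k fzero    (fsuc j) = ⊤
WheelAdj k (fsuc i) fzero    = ⊤
WheelAdj k (fsuc i) (fsuc j) = CycleAdj k i j

WheelInducedInConflict : {n₁ n₂ m₁ m₂ : ℕ} → Instance n₁ n₂ m₁ m₂ → ℕ → Set
WheelInducedInConflict I k =
  Σ (Fin (suc k) → C4 I) λ f →
      (∀ i j → i ≢ j → ¬ SameC4 I (f i) (f j))
    × (∀ i j → i ≢ j → (Conflict I (f i) (f j) ⇔ WheelAdj k i j))

-- With m₂ = 1 every vertex of V₂ has a single S-neighbour, so two c4s conflict exactly when,
-- read as partial maps V₁ ⇀ V₂, they disagree at some point. Let the hub have domain {P, Q};
-- every rim c4 conflicts with it and hence touches P or Q. Reading the rim as a sequence
-- r₀, r₁, … (indices mod k), r_i conflicts with r_{i+1} and, as k ≥ 7, is compatible with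
-- r_{i+g} for 2 ≤ g ≤ 5; nothing else about the wheel is used. Then consecutive r_i, r_{i+1}
-- agree at P and at Q, for otherwise r_{i+2}, …, r_{i+6} cannot be placed. So each conflict
-- along r₀, r₁, r₂, r₃ happens at points other than their anchors in {P, Q}; these points
-- coincide, and r₃ then forces r₀ and r₁ to agree there too, a contradiction.

module Submission where

open import Defs hiding (sym)
open import Data.Nat using (ℕ; zero; suc; _≤_; _<_; _+_; _*_; _∸_; _≤ᵇ_; z≤n; s≤s; NonZero)
open import Data.Nat.DivMod
  using (_%_; _/_; m%n<n; m<n⇒m%n≡m; [m+n]%n≡m%n; [m+kn]%n≡m%n; m≡m%n+[m/n]*n)
open import Data.Nat.Properties
  using ( ≤-trans; n≤1+n; ≤ᵇ⇒≤; _<?_; ≮⇒≥; 1+n≰n; <⇒≢; <⇒≤; n≤0⇒n≡0; m+n≤o⇒n≤o; m<n+m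
        ; m+[n∸m]≡n; m∸n+n≡m; +-assoc; +-comm; +-identityʳ; +-monoˡ-≤; +-monoʳ-≤; +-mono-≤-<
        ; +-cancelˡ-<; +-cancelˡ-≤; +-cancelʳ-≤; +-cancelʳ-≡; module ≤-Reasoning)
open import Data.Fin using (Fin; toℕ; fromℕ<; _≟_) renaming (zero to fzero; suc to fsuc)
open import Data.Fin.Properties using (toℕ-fromℕ<; toℕ<n; suc-injective)
open import Data.Bool using (true; T)
open import Data.Unit using (tt)
open import Data.List using (List; []; _∷_; length; filterᵇ; allFin)
open import Data.List.Membership.Propositional using (_∈_)
open import Data.List.Membership.Propositional.Properties using (∈-filter⁺; ∈-allFin)
open import Data.List.Relation.Unary.Any using (here; there)
open import Data.Product using (∃; ∃₂; _×_; _,_; proj₁; proj₂)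
open import Data.Sum using (_⊎_; inj₁; inj₂; [_,_]′; swap)
open import Function using (_∘_; id)
open import Function.Bundles using (_⇔_; Equivalence)
open import Data.Empty using (⊥; ⊥-elim)
open import Relation.Binary.PropositionalEquality
  using (_≡_; _≢_; refl; sym; trans; cong; subst; subst₂; module ≡-Reasoning)
open import Relation.Nullary using (¬_; yes; no; Dec)
open import Relation.Nullary.Decidable using (decidable-stable)
open import Relation.Nullary.Decidable.Core using (T?)

∈-distinct⇒2≤length : ∀ {A : Set} {x y : A} {xs : List A} →
                      x ∈ xs → y ∈ xs → x ≢ y → 2 ≤ length xs
∈-distinct⇒2≤length (here refl) (here refl)              x≢y = ⊥-elim (x≢y refl)
∈-distinct⇒2≤length (here refl) (there {xs = _ ∷ _} _)   _   = s≤s (s≤s z≤n)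
∈-distinct⇒2≤length (there {xs = _ ∷ _} _) (here refl)   _   = s≤s (s≤s z≤n)
∈-distinct⇒2≤length (there x∈) (there y∈) x≢y =
  ≤-trans (∈-distinct⇒2≤length x∈ y∈ x≢y) (n≤1+n _)

module _ {n₁ n₂ m₁ : ℕ} (I : Instance n₁ n₂ m₁ 1) where

  private
    V₁ = Fin n₁
    V₂ = Fin n₂
    Q4 = C4 I

  sim-injective : ∀ {u u' : V₁} {v : V₂} → sim I u v ≡ true → sim I u' v ≡ true → u ≡ u'
  sim-injective {u} {u'} {v} uv u'v = decidable-stable (u ≟ u') λ u≢u' →
    2≰1 (≤-trans (∈-distinct⇒2≤length (neighbour uv) (neighbour u'v) u≢u') (deg₂ I v))
    where
      neighbour : ∀ {w} → sim I w v ≡ true → w ∈ filterᵇ (λ a → sim I a v) (allFin n₁)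
      neighbour {w} wv = ∈-filter⁺ (λ a → T? (sim I a v)) (∈-allFin w) (subst T (sym wv) tt)
      2≰1 : ¬ (2 ≤ 1)
      2≰1 (s≤s ())

  -- A c4 q is read as the partial map {a ↦ d, b ↦ c} from V₁ to V₂.
  data Maps (q : Q4) (u : V₁) (v : V₂) : Set where
    maps-ad : C4.a q ≡ u → C4.d q ≡ v → Maps q u v
    maps-bc : C4.b q ≡ u → C4.c q ≡ v → Maps q u v

  Touches : Q4 → V₁ → Set
  Touches q u = ∃ (Maps q u)

  AgreeAt : Q4 → Q4 → V₁ → Set
  AgreeAt p q u = ∀ {v v'} → Maps p u v → Maps q u v' → v ≡ v'

  Compatible : Q4 → Q4 → Set
  Compatible p q = ∀ {u} → AgreeAt p q u

  Edges : Q4 → V₁ → V₂ → V₁ → V₂ → Set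
  Edges q u v u' v' = Maps q u v × Maps q u' v' × u ≢ u'

  a≢b : (q : Q4) → C4.a q ≢ C4.b q
  a≢b q a≡b with trans (sym (irrfl (G₁ I) (C4.b q)))
                       (subst (λ x → adj (G₁ I) x (C4.b q) ≡ true) a≡b (C4.ab∈E₁ q))
  ... | ()

  maps-functional : ∀ {q u v v'} → Maps q u v → Maps q u v' → v ≡ v'
  maps-functional (maps-ad refl refl) (maps-ad refl refl) = refl
  maps-functional {q} (maps-ad refl refl) (maps-bc b≡a _) = ⊥-elim (a≢b q (sym b≡a))
  maps-functional {q} (maps-bc b≡a _) (maps-ad refl refl) = ⊥-elim (a≢b q (sym b≡a))
  maps-functional (maps-bc refl refl) (maps-bc refl refl) = refl

  maps⇒sim : ∀ {q u v} → Maps q u v → sim I u v ≡ true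
  maps⇒sim {q} (maps-ad refl refl) = C4.ad∈S q
  maps⇒sim {q} (maps-bc refl refl) = C4.bc∈S q

  touches? : ∀ q u → Dec (Touches q u)
  touches? q u with C4.a q ≟ u | C4.b q ≟ u
  ... | yes a≡u | _     = yes (C4.d q , maps-ad a≡u refl)
  ... | no _    | yes b≡u = yes (C4.c q , maps-bc b≡u refl)
  ... | no a≢u  | no b≢u  = no λ { (_ , maps-ad a≡u _) → a≢u a≡u
                                 ; (_ , maps-bc b≡u _) → b≢u b≡u }

  edges-of : ∀ {q u v} → Maps q u v → ∃₂ λ u' v' → Edges q u v u' v'
  edges-of {q} m@(maps-ad refl refl) = C4.b q , C4.c q , m , maps-bc refl refl , a≢b q
  edges-of {q} m@(maps-bc refl refl) = C4.a q , C4.d q , m , maps-ad refl refl , a≢b q ∘ sym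

  edges-cover : ∀ {q u v u' v' w x} → Edges q u v u' v' → Maps q w x →
                (w ≡ u × x ≡ v) ⊎ (w ≡ u' × x ≡ v')
  edges-cover (maps-ad refl refl , maps-ad refl refl , u≢u') _ = ⊥-elim (u≢u' refl)
  edges-cover (maps-bc refl refl , maps-bc refl refl , u≢u') _ = ⊥-elim (u≢u' refl)
  edges-cover (maps-ad refl refl , maps-bc refl refl , _) (maps-ad refl refl) = inj₁ (refl , refl)
  edges-cover (maps-ad refl refl , maps-bc refl refl , _) (maps-bc refl refl) = inj₂ (refl , refl)
  edges-cover (maps-bc refl refl , maps-ad refl refl , _) (maps-ad refl refl) = inj₂ (refl , refl)
  edges-cover (maps-bc refl refl , maps-ad refl refl , _) (maps-bc refl refl) = inj₁ (refl , refl)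

  edges⇒same : ∀ {p q u v u' v'} → Edges p u v u' v' → Edges q u v u' v' → SameC4 I p q
  edges⇒same (maps-ad refl refl , maps-ad refl refl , u≢u') _ = ⊥-elim (u≢u' refl)
  edges⇒same (maps-bc refl refl , maps-bc refl refl , u≢u') _ = ⊥-elim (u≢u' refl)
  edges⇒same _ (maps-ad e _ , maps-ad e' _ , u≢u') = ⊥-elim (u≢u' (trans (sym e) e'))
  edges⇒same _ (maps-bc e _ , maps-bc e' _ , u≢u') = ⊥-elim (u≢u' (trans (sym e) e'))
  edges⇒same (maps-ad refl refl , maps-bc refl refl , _) (maps-ad e₁ e₂ , maps-bc e₃ e₄ , _) =
    inj₁ (sym e₁ , sym e₃ , sym e₄ , sym e₂)
  edges⇒same (maps-ad refl refl , maps-bc refl refl , _) (maps-bc e₁ e₂ , maps-ad e₃ e₄ , _) =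
    inj₂ (sym e₁ , sym e₃ , sym e₄ , sym e₂)
  edges⇒same (maps-bc refl refl , maps-ad refl refl , _) (maps-ad e₁ e₂ , maps-bc e₃ e₄ , _) =
    inj₂ (sym e₃ , sym e₁ , sym e₂ , sym e₄)
  edges⇒same (maps-bc refl refl , maps-ad refl refl , _) (maps-bc e₁ e₂ , maps-ad e₃ e₄ , _) =
    inj₁ (sym e₃ , sym e₁ , sym e₂ , sym e₄)

  maps⇒∈ : ∀ {q u v} {M : List (SimEdge I)} →
           simEdge₁ I q ∈ M → simEdge₂ I q ∈ M → Maps q u v → (u , v) ∈ M
  maps⇒∈ ad∈M _    (maps-ad refl refl) = ad∈M
  maps⇒∈ _    bc∈M (maps-bc refl refl) = bc∈M

  ¬conflict⇒compatible : ∀ {p q} → ¬ Conflict I p q → Compatible p q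
  ¬conflict⇒compatible p¬q {u} {v} {v'} m n = decidable-stable (v ≟ v') λ v≢v' →
    p¬q λ { (M , (_ , matching) , p₁ , p₂ , q₁ , q₂) →
      clash v≢v' (matching (maps⇒∈ p₁ p₂ m) (maps⇒∈ q₁ q₂ n)) }
    where
      clash : ∀ {v v'} → v ≢ v' → (u , v) ≡ (u , v') ⊎ (u ≢ u × v ≢ v') → ⊥
      clash v≢v' (inj₁ refl)      = v≢v' refl
      clash _    (inj₂ (u≢u , _)) = u≢u refl

  private
    edgeList : Q4 → Q4 → List (SimEdge I)
    edgeList p q = simEdge₁ I p ∷ simEdge₂ I p ∷ simEdge₁ I q ∷ simEdge₂ I q ∷ []

    ∈edgeList⇒maps : ∀ {p q e} → e ∈ edgeList p q →
                     Maps p (proj₁ e) (proj₂ e) ⊎ Maps q (proj₁ e) (proj₂ e)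
    ∈edgeList⇒maps (here refl)                         = inj₁ (maps-ad refl refl)
    ∈edgeList⇒maps (there (here refl))                 = inj₁ (maps-bc refl refl)
    ∈edgeList⇒maps (there (there (here refl)))         = inj₂ (maps-ad refl refl)
    ∈edgeList⇒maps (there (there (there (here refl)))) = inj₂ (maps-bc refl refl)

  -- With m₂ = 1 the only obstruction to a common matching is a clash at a point of V₁:
  -- two edges of S at distinct points of V₁ never share their endpoint in V₂.
  compatible⇒¬conflict : ∀ {p q} → Compatible p q → ¬ Conflict I p q
  compatible⇒¬conflict {p} {q} p~q p≁q =
    p≁q (edgeList p q , (in-S , disjoint) ,
         here refl , there (here refl) , there (there (here refl)) , there (there (there (here refl))))
    where
      functional : ∀ {u v v'} → Maps p u v ⊎ Maps q u v → Maps p u v' ⊎ Maps q u v' → v ≡ v'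
      functional (inj₁ m) (inj₁ m') = maps-functional m m'
      functional (inj₁ m) (inj₂ n)  = p~q m n
      functional (inj₂ n) (inj₁ m)  = sym (p~q m n)
      functional (inj₂ n) (inj₂ n') = maps-functional n n'
      in-S : ∀ {e} → e ∈ edgeList p q → sim I (proj₁ e) (proj₂ e) ≡ true
      in-S e∈ = [ maps⇒sim {p} , maps⇒sim {q} ]′ (∈edgeList⇒maps e∈)
      disjoint : ∀ {e e'} → e ∈ edgeList p q → e' ∈ edgeList p q →
                 e ≡ e' ⊎ (proj₁ e ≢ proj₁ e' × proj₂ e ≢ proj₂ e')
      disjoint {u , v} {u' , v'} e∈ e'∈ with u ≟ u'
      ... | yes refl = inj₁ (cong (u ,_) (functional (∈edgeList⇒maps e∈) (∈edgeList⇒maps e'∈)))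
      ... | no u≢u'  = inj₂ (u≢u' , λ { refl → u≢u' (sim-injective (in-S e∈) (in-S e'∈)) })

  incompatible⇒meets : ∀ {p q} → ¬ Compatible p q → Touches q (C4.a p) ⊎ Touches q (C4.b p)
  incompatible⇒meets {p} {q} p≁q with touches? q (C4.a p) | touches? q (C4.b p)
  ... | yes touches-a | _         = inj₁ touches-a
  ... | no _          | yes touches-b = inj₂ touches-b
  ... | no misses-a   | no misses-b = ⊥-elim (p≁q λ
        { (maps-ad refl refl) n → ⊥-elim (misses-a (_ , n))
        ; (maps-bc refl refl) n → ⊥-elim (misses-b (_ , n)) })

  compatible-sym : ∀ {p q} → Compatible p q → Compatible q p
  compatible-sym p~q m n = sym (p~q n m)

  agree-at-shared : ∀ {p q u v} → Maps p u v → Maps q u v → AgreeAt p q u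
  agree-at-shared m n m' n' = trans (maps-functional m' m) (maps-functional n n')

  missing-if-disagreeing : ∀ {p p' q u v v'} → Maps p u v → Maps p' u v' → v ≢ v' →
                           Compatible p q → Compatible p' q → ¬ Touches q u
  missing-if-disagreeing m m' v≢v' p~q p'~q (_ , n) = v≢v' (trans (p~q m n) (sym (p'~q m' n)))

  compatible-from-edges : ∀ {p q u v u' v'} → Edges p u v u' v' →
                          AgreeAt p q u → AgreeAt p q u' → Compatible p q
  compatible-from-edges e agree agree' m n with edges-cover e m
  ... | inj₁ (refl , _) = agree m n
  ... | inj₂ (refl , _) = agree' m n

  incompatible⇒other-points-equal : ∀ {p q u v c z u' v' c' z'} →
    Edges p u v c z → Edges q u' v' c' z' → AgreeAt p q u → AgreeAt p q u' →
    ¬ Compatible p q → c ≡ c'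
  incompatible⇒other-points-equal {c = c} {c' = c'} ep eq agree agree' p≁q =
    decidable-stable (c ≟ c') λ c≢c' → p≁q (compatible-from-edges ep agree (agree-at-c c≢c'))
    where
      agree-at-c : c ≢ c' → AgreeAt _ _ c
      agree-at-c c≢c' m n with edges-cover eq n
      ... | inj₁ (refl , _) = agree' m n
      ... | inj₂ (refl , _) = ⊥-elim (c≢c' refl)

  incompatible-path-through-edge⇒same : ∀ {t₁ t₂ t₃ u v} →
    Maps t₁ u v → Maps t₂ u v → Maps t₃ u v →
    ¬ Compatible t₁ t₂ → ¬ Compatible t₂ t₃ → Compatible t₁ t₃ → SameC4 I t₁ t₃
  incompatible-path-through-edge⇒same m₁ m₂ m₃ t₁≁t₂ t₂≁t₃ t₁~t₃
    with edges-of m₁ | edges-of m₂ | edges-of m₃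
  ... | c₁ , z₁ , e₁@(_ , n₁ , u≢c₁) | c₂ , z₂ , e₂ | c₃ , z₃ , e₃@(_ , n₃ , _) =
    edges⇒same e₁ (m₃ , subst (Maps _ c₁) (sym z₁≡z₃) n₃′ , u≢c₁)
    where
      c₁≡c₃ : c₁ ≡ c₃
      c₁≡c₃ = trans
        (incompatible⇒other-points-equal e₁ e₂ (agree-at-shared m₁ m₂) (agree-at-shared m₁ m₂) t₁≁t₂)
        (incompatible⇒other-points-equal e₂ e₃ (agree-at-shared m₂ m₃) (agree-at-shared m₂ m₃) t₂≁t₃)
      n₃′ : Maps _ c₁ z₃
      n₃′ = subst (λ c → Maps _ c z₃) (sym c₁≡c₃) n₃
      z₁≡z₃ : z₁ ≡ z₃
      z₁≡z₃ = t₁~t₃ n₁ n₃′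

  Meets : Q4 → (V₁ → Set) → Set
  Meets q A = ∃ λ u → A u × Touches q u

  AgreeOn : (V₁ → Set) → Q4 → Q4 → Set
  AgreeOn A p q = ∀ {u} → A u → AgreeAt p q u

  no-incompatible-path-of-four : ∀ {A t₁ t₂ t₃ t₄} →
    Meets t₁ A → Meets t₂ A → Meets t₃ A → Meets t₄ A →
    AgreeOn A t₁ t₂ → AgreeOn A t₂ t₃ → AgreeOn A t₃ t₄ →
    ¬ Compatible t₁ t₂ → ¬ Compatible t₂ t₃ → ¬ Compatible t₃ t₄ →
    Compatible t₁ t₄ → Compatible t₂ t₄ → ⊥
  no-incompatible-path-of-four (_ , A₁ , _ , m₁) (_ , A₂ , _ , m₂) (_ , A₃ , _ , m₃) (_ , A₄ , _ , m₄)
    a₁₂ a₂₃ a₃₄ t₁≁t₂ t₂≁t₃ t₃≁t₄ t₁~t₄ t₂~t₄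
    with edges-of m₁ | edges-of m₂ | edges-of m₃ | edges-of m₄
  ... | c₁ , z₁ , e₁@(_ , n₁ , _) | c₂ , z₂ , e₂@(_ , n₂ , _) | _ , _ , e₃ | c₄ , z₄ , e₄@(_ , n₄ , _) =
    t₁≁t₂ (compatible-from-edges e₁ (a₁₂ A₁) agree-at-c₁)
    where
      c₂≡c₄ : c₂ ≡ c₄
      c₂≡c₄ = trans (incompatible⇒other-points-equal e₂ e₃ (a₂₃ A₂) (a₂₃ A₃) t₂≁t₃)
                    (incompatible⇒other-points-equal e₃ e₄ (a₃₄ A₃) (a₃₄ A₄) t₃≁t₄)
      c₁≡c₂ : c₁ ≡ c₂
      c₁≡c₂ = incompatible⇒other-points-equal e₁ e₂ (a₁₂ A₁) (a₁₂ A₂) t₁≁t₂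
      z₁≡z₄ : z₁ ≡ z₄
      z₁≡z₄ = t₁~t₄ n₁ (subst (λ c → Maps _ c z₄) (sym (trans c₁≡c₂ c₂≡c₄)) n₄)
      z₂≡z₄ : z₂ ≡ z₄
      z₂≡z₄ = t₂~t₄ n₂ (subst (λ c → Maps _ c z₄) (sym c₂≡c₄) n₄)
      agree-at-c₁ : AgreeAt _ _ c₁
      agree-at-c₁ m n = trans (maps-functional m n₁)
        (trans z₁≡z₄ (trans (sym z₂≡z₄) (maps-functional (subst (λ c → Maps _ c z₂) (sym c₁≡c₂) n₂) n)))

  module _ (rim : ℕ → Q4)
           (step-incompatible : ∀ i → ¬ Compatible (rim i) (rim (suc i)))
           (gap-compatible : ∀ g i → 2 ≤ g → g ≤ 5 → Compatible (rim i) (rim (g + i)))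
           (gap₂-distinct : ∀ i → ¬ SameC4 I (rim i) (rim (2 + i))) where

    private
      compatible-at : ∀ g {2≤g : T (2 ≤ᵇ g)} {g≤5 : T (g ≤ᵇ 5)} i → Compatible (rim i) (rim (g + i))
      compatible-at g {2≤g} {g≤5} i = gap-compatible g i (≤ᵇ⇒≤ 2 g 2≤g) (≤ᵇ⇒≤ g 5 g≤5)

    module _ {P Q : V₁} (meets : ∀ i → Touches (rim i) P ⊎ Touches (rim i) Q) where

      -- Vertices 3+i, 4+i, 5+i miss P, so they touch Q with values y, y', y, and y ≢ y' because
      -- 3+i and 5+i are distinct. Then 2+i and 6+i miss Q and carry the P-values of i and 1+i,
      -- yet they are compatible.
      module ConsecutiveDisagreement {i x₀ x₁} (m₀ : Maps (rim i) P x₀) (m₁ : Maps (rim (suc i)) P x₁)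
                                     (x₀≢x₁ : x₀ ≢ x₁) where

        touches-Q : ∀ {j} → Compatible (rim i) (rim j) → Compatible (rim (suc i)) (rim j) → Touches (rim j) Q
        touches-Q i~j 1+i~j = [ ⊥-elim ∘ missing-if-disagreeing m₀ m₁ x₀≢x₁ i~j 1+i~j , id ]′ (meets _)

        touches-P : ∀ {j} → ¬ Touches (rim j) Q → Touches (rim j) P
        touches-P misses-Q = [ id , ⊥-elim ∘ misses-Q ]′ (meets _)

        Q₃ : Touches (rim (3 + i)) Q
        Q₃ = touches-Q (compatible-at 3 i) (compatible-at 2 (suc i))
        Q₄ : Touches (rim (4 + i)) Q
        Q₄ = touches-Q (compatible-at 4 i) (compatible-at 3 (suc i))
        Q₅ : Touches (rim (5 + i)) Q
        Q₅ = touches-Q (compatible-at 5 i) (compatible-at 4 (suc i))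

        y₃≡y₅ : proj₁ Q₃ ≡ proj₁ Q₅
        y₃≡y₅ = compatible-at 2 (3 + i) (proj₂ Q₃) (proj₂ Q₅)

        y₃≢y₄ : proj₁ Q₃ ≢ proj₁ Q₄
        y₃≢y₄ y₃≡y₄ = gap₂-distinct (3 + i) (incompatible-path-through-edge⇒same
          (proj₂ Q₃) (subst (Maps _ Q) (sym y₃≡y₄) (proj₂ Q₄))
          (subst (Maps _ Q) (sym y₃≡y₅) (proj₂ Q₅))
          (step-incompatible (3 + i)) (step-incompatible (4 + i)) (compatible-at 2 (3 + i)))

        P₂ : Touches (rim (2 + i)) P
        P₂ = touches-P (missing-if-disagreeing (proj₂ Q₄) (proj₂ Q₅)
               (λ y₄≡y₅ → y₃≢y₄ (trans y₃≡y₅ (sym y₄≡y₅)))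
               (compatible-sym (compatible-at 2 (2 + i))) (compatible-sym (compatible-at 3 (2 + i))))
        P₆ : Touches (rim (6 + i)) P
        P₆ = touches-P (missing-if-disagreeing (proj₂ Q₃) (proj₂ Q₄) y₃≢y₄
               (compatible-at 3 (3 + i)) (compatible-at 2 (4 + i)))

        impossible : ⊥
        impossible = x₀≢x₁ (trans (compatible-at 2 i m₀ (proj₂ P₂))
                        (trans (compatible-at 4 (2 + i) (proj₂ P₂) (proj₂ P₆))
                               (sym (compatible-at 5 (suc i) m₁ (proj₂ P₆)))))

      consecutive-agree : ∀ i → AgreeAt (rim i) (rim (suc i)) P
      consecutive-agree i m₀ m₁ =
        decidable-stable (_ ≟ _) (ConsecutiveDisagreement.impossible m₀ m₁)

    no-rim-meeting-pair : ∀ P Q → ¬ (∀ i → Touches (rim i) P ⊎ Touches (rim i) Q)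
    no-rim-meeting-pair P Q meets =
      no-incompatible-path-of-four (meets-pair 0) (meets-pair 1) (meets-pair 2) (meets-pair 3)
        (agree 0) (agree 1) (agree 2)
        (step-incompatible 0) (step-incompatible 1) (step-incompatible 2)
        (compatible-at 3 0) (compatible-at 2 1)
      where
        Pair : V₁ → Set
        Pair u = u ≡ P ⊎ u ≡ Q
        meets-pair : ∀ i → Meets (rim i) Pair
        meets-pair i = [ (λ touches-P → P , inj₁ refl , touches-P)
                       , (λ touches-Q → Q , inj₂ refl , touches-Q) ]′ (meets i)
        agree : ∀ i → AgreeOn Pair (rim i) (rim (suc i))
        agree i (inj₁ refl) = consecutive-agree meets i
        agree i (inj₂ refl) = consecutive-agree (swap ∘ meets) i

%-small-or-wrapped : ∀ n k .{{_ : NonZero k}} → n < k + k → n ≡ n % k ⊎ n ≡ k + n % k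
%-small-or-wrapped n k n<2k with n <? k
... | yes n<k = inj₁ (sym (m<n⇒m%n≡m n<k))
... | no n≮k  = inj₂ (begin
  n                   ≡⟨ sym (m+[n∸m]≡n k≤n) ⟩
  k + (n ∸ k)         ≡⟨ cong (k +_) (sym (m<n⇒m%n≡m n∸k<k)) ⟩
  k + (n ∸ k) % k     ≡⟨ cong (k +_) (sym ([m+n]%n≡m%n (n ∸ k) k)) ⟩
  k + (n ∸ k + k) % k ≡⟨ cong (λ m → k + m % k) (m∸n+n≡m k≤n) ⟩
  k + n % k           ∎)
  where
    open ≡-Reasoning
    k≤n : k ≤ n
    k≤n = ≮⇒≥ n≮k
    n∸k<k : n ∸ k < k
    n∸k<k = +-cancelˡ-< k (n ∸ k) k (subst (_< k + k) (sym (m+[n∸m]≡n k≤n)) n<2k)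

module _ {k : ℕ} .{{_ : NonZero k}} where

  position : ℕ → Fin k
  position i = fromℕ< (m%n<n i k)

  CycleShift : ℕ → Fin k → Fin k → Set
  CycleShift g x y = g + toℕ x ≡ toℕ y ⊎ g + toℕ x ≡ k + toℕ y

  position-shift : ∀ g i → g ≤ k → CycleShift g (position i) (position (g + i))
  position-shift g i g≤k =
    subst₂ (λ a b → g + a ≡ b ⊎ g + a ≡ k + b) (sym (toℕ-fromℕ< _)) (sym (toℕ-fromℕ< _))
      (subst (λ r → g + i % k ≡ r ⊎ g + i % k ≡ k + r) (sym [g+i]%k≡[g+i%k]%k)
        (%-small-or-wrapped (g + i % k) k (+-mono-≤-< g≤k (m%n<n i k))))
    where
      open ≡-Reasoning
      [g+i]%k≡[g+i%k]%k : (g + i) % k ≡ (g + i % k) % k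
      [g+i]%k≡[g+i%k]%k = begin
        (g + i) % k                   ≡⟨ cong (λ n → (g + n) % k) (m≡m%n+[m/n]*n i k) ⟩
        (g + (i % k + i / k * k)) % k ≡⟨ cong (_% k) (sym (+-assoc g (i % k) (i / k * k))) ⟩
        (g + i % k + i / k * k) % k   ≡⟨ [m+kn]%n≡m%n (g + i % k) (i / k) k ⟩
        (g + i % k) % k               ∎

  shift₁⇒adjacent : ∀ {x y} → CycleShift 1 x y → CycleAdj k x y
  shift₁⇒adjacent (inj₁ 1+x≡y) = inj₁ 1+x≡y
  shift₁⇒adjacent {x} {y} (inj₂ 1+x≡k+y) =
    inj₂ (inj₂ (inj₂ (y≡0 , trans 1+x≡k+y (trans (cong (k +_) y≡0) (+-identityʳ k)))))
    where
      open ≤-Reasoning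
      y≡0 : toℕ y ≡ 0
      y≡0 = n≤0⇒n≡0 (+-cancelˡ-≤ k (toℕ y) 0 (begin
        k + toℕ y    ≡⟨ sym 1+x≡k+y ⟩
        suc (toℕ x)  ≤⟨ toℕ<n x ⟩
        k            ≡⟨ sym (+-identityʳ k) ⟩
        k + 0        ∎))

  adjacent-sym : ∀ {x y} → CycleAdj k x y → CycleAdj k y x
  adjacent-sym (inj₁ e)               = inj₂ (inj₁ e)
  adjacent-sym (inj₂ (inj₁ e))        = inj₁ e
  adjacent-sym (inj₂ (inj₂ (inj₁ e))) = inj₂ (inj₂ (inj₂ e))
  adjacent-sym (inj₂ (inj₂ (inj₂ e))) = inj₂ (inj₂ (inj₁ e))

  far-apart⇒nonadjacent : ∀ {x y} → 2 + toℕ x ≤ toℕ y → 2 + toℕ y ≤ toℕ x + k → ¬ CycleAdj k x y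
  far-apart⇒nonadjacent {x} l₁ _ (inj₁ 1+x≡y) = 1+n≰n (subst (2 + toℕ x ≤_) (sym 1+x≡y) l₁)
  far-apart⇒nonadjacent {_} {y} l₁ _ (inj₂ (inj₁ 1+y≡x)) =
    1+n≰n (m+n≤o⇒n≤o 2 (subst (λ a → 2 + a ≤ toℕ y) (sym 1+y≡x) l₁))
  far-apart⇒nonadjacent {_} {y} _ l₂ (inj₂ (inj₂ (inj₁ (x≡0 , 1+y≡k)))) =
    1+n≰n (subst (2 + toℕ y ≤_) (sym 1+y≡k) (subst (λ a → 2 + toℕ y ≤ a + k) x≡0 l₂))
  far-apart⇒nonadjacent {x} l₁ _ (inj₂ (inj₂ (inj₂ (y≡0 , _)))) with subst (2 + toℕ x ≤_) y≡0 l₁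
  ... | ()

  shift⇒nonadjacent : ∀ {g x y} → 2 ≤ g → 2 + g ≤ k → CycleShift g x y → ¬ CycleAdj k x y
  shift⇒nonadjacent {g} {x} {y} 2≤g 2+g≤k (inj₁ g+x≡y) = far-apart⇒nonadjacent
    (begin 2 + toℕ x ≤⟨ +-monoˡ-≤ (toℕ x) 2≤g ⟩ g + toℕ x ≡⟨ g+x≡y ⟩ toℕ y ∎)
    (begin
      2 + toℕ y        ≡⟨ cong (2 +_) (sym g+x≡y) ⟩
      2 + g + toℕ x    ≤⟨ +-monoˡ-≤ (toℕ x) 2+g≤k ⟩
      k + toℕ x        ≡⟨ +-comm k (toℕ x) ⟩
      toℕ x + k        ∎)
    where open ≤-Reasoning
  shift⇒nonadjacent {g} {x} {y} 2≤g 2+g≤k (inj₂ g+x≡k+y) = far-apart⇒nonadjacent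
    (+-cancelʳ-≤ k (2 + toℕ y) (toℕ x) (begin
      2 + (toℕ y + k)  ≡⟨ cong (2 +_) (trans (+-comm (toℕ y) k) (sym g+x≡k+y)) ⟩
      2 + g + toℕ x    ≤⟨ +-monoˡ-≤ (toℕ x) 2+g≤k ⟩
      k + toℕ x        ≡⟨ +-comm k (toℕ x) ⟩
      toℕ x + k        ∎))
    (begin
      2 + toℕ x        ≤⟨ +-monoˡ-≤ (toℕ x) 2≤g ⟩
      g + toℕ x        ≡⟨ g+x≡k+y ⟩
      k + toℕ y        ≡⟨ +-comm k (toℕ y) ⟩
      toℕ y + k        ∎)
    ∘ adjacent-sym
    where open ≤-Reasoning

  shift⇒distinct : ∀ {g x y} → 0 < g → g < k → CycleShift g x y → x ≢ y
  shift⇒distinct {x = x} 0<g _ (inj₁ g+x≡y) refl = <⇒≢ (m<n+m (toℕ x) 0<g) (sym g+x≡y)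
  shift⇒distinct {g} {x} _ g<k (inj₂ g+x≡k+x) refl = <⇒≢ g<k (+-cancelʳ-≡ (toℕ x) g k g+x≡k+x)

module InducedWheel {n₁ n₂ m₁ k : ℕ} (I : Instance n₁ n₂ m₁ 1) .{{_ : NonZero k}}
                    (7≤k : 7 ≤ k)
                    (f : Fin (suc k) → C4 I)
                    (distinct : ∀ i j → i ≢ j → ¬ SameC4 I (f i) (f j))
                    (conflict⇔adjacent : ∀ i j → i ≢ j →
                                         Conflict I (f i) (f j) ⇔ WheelAdj k i j) where

  hub : C4 I
  hub = f fzero

  rim : ℕ → C4 I
  rim i = f (fsuc (position i))

  private
    conflict⇒incompatible : ∀ {p q} → Conflict I p q → ¬ Compatible I p q
    conflict⇒incompatible p≁q p~q = compatible⇒¬conflict I p~q p≁q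

    rim-distinct : ∀ {g} i → 0 < g → g < k → fsuc (position i) ≢ fsuc (position (g + i))
    rim-distinct {g} i 0<g g<k = shift⇒distinct 0<g g<k (position-shift g i (<⇒≤ g<k)) ∘ suc-injective

  hub-incompatible : ∀ i → ¬ Compatible I hub (rim i)
  hub-incompatible i = conflict⇒incompatible (Equivalence.from (conflict⇔adjacent fzero _ λ ()) tt)

  step-incompatible : ∀ i → ¬ Compatible I (rim i) (rim (suc i))
  step-incompatible i = conflict⇒incompatible
    (Equivalence.from (conflict⇔adjacent _ _ (rim-distinct i (s≤s z≤n) 1<k))
                      (shift₁⇒adjacent (position-shift 1 i (<⇒≤ 1<k))))
    where
      1<k : 1 < k
      1<k = ≤-trans (≤ᵇ⇒≤ 2 7 tt) 7≤k

  gap-compatible : ∀ g i → 2 ≤ g → g ≤ 5 → Compatible I (rim i) (rim (g + i))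
  gap-compatible g i 2≤g g≤5 = ¬conflict⇒compatible I λ rim-conflict →
    shift⇒nonadjacent 2≤g 2+g≤k (position-shift g i (<⇒≤ g<k))
      (Equivalence.to (conflict⇔adjacent _ _ (rim-distinct i 0<g g<k)) rim-conflict)
    where
      2+g≤k : 2 + g ≤ k
      2+g≤k = ≤-trans (+-monoʳ-≤ 2 g≤5) 7≤k
      g<k : g < k
      g<k = ≤-trans (n≤1+n (suc g)) 2+g≤k
      0<g : 0 < g
      0<g = ≤-trans (s≤s z≤n) 2≤g

  gap₂-distinct : ∀ i → ¬ SameC4 I (rim i) (rim (2 + i))
  gap₂-distinct i = distinct _ _ (rim-distinct i (s≤s z≤n) (≤-trans (≤ᵇ⇒≤ 3 7 tt) 7≤k))

theorem10 : ∀ {n₁ n₂ m₁ : ℕ} → 1 ≤ m₁ → (I : Instance n₁ n₂ m₁ 1) →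
    ∀ (k : ℕ) → 7 ≤ k → ¬ WheelInducedInConflict I k
theorem10 _ I zero () _
theorem10 _ I (suc k) 7≤k (f , distinct , conflict⇔adjacent) =
  no-rim-meeting-pair I rim step-incompatible gap-compatible gap₂-distinct
    (C4.a hub) (C4.b hub) (incompatible⇒meets I ∘ hub-incompatible)
  where open InducedWheel I 7≤k f distinct conflict⇔adjacent
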